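{- In the negation–conjunction sequent system $\mathcal{N}$, with implication defined by $P\supset Q:=\,\sim(P\,.\,\sim Q)$, the following rules are derivable for all formulas $P,Q$ and every finite sequence of formulas $\Delta$: (i) if $\Delta,P\rightarrow Q$ is provable, then $\Delta\rightarrow\,\sim(P\,.\,\sim Q)$ is provable; (ii) if $\Delta\rightarrow P$ and $\Delta\rightarrow\,\sim(P\,.\,\sim Q)$ are provable, then $\Delta\rightarrow Q$ is provable.
   Context: Formulas are built from propositional letters with the connectives $\sim$ (negation) and $.$ (conjunction, written $P\,.\,Q$). A sequent has the form $\Delta\rightarrow P$, where $\Delta$ is a finite, possibly empty, sequence of formulas and $P$ is a formula. The system $\mathcal{N}$ has as axioms all sequents $P\rightarrow P$ and the rules: thinning: from $\Delta\rightarrow Q$ infer $P,\Delta\rightarrow Q$, and from $\Delta\rightarrow Q$ infer $\Delta,P\rightarrow Q$; conjunction introduction: from $\Delta\rightarrow P$ and $\Delta\rightarrow Q$ infer $\Delta\rightarrow P\,.\,Q$; conjunction eliminations: from $\Delta\rightarrow P\,.\,Q$ infer $\Delta\rightarrow P$, and from $\Delta\rightarrow P\,.\,Q$ infer $\Delta\rightarrow Q$; simple cut: from $R\rightarrow P$ and $\Delta,P\rightarrow Q$ infer $\Delta,R\rightarrow Q$; reductio ad absurdum: from $\Delta,\sim P\rightarrow Q$ and $\Delta,\sim P\rightarrow\,\sim Q$ infer $\Delta\rightarrow P$. A sequent is provable if it is obtained from axioms by finitely many rule applications. -}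

module Defs where

open import Data.Nat using (ℕ)
open import Data.List using (List; []; _∷_; [_]; _++_)

data Formula : Set where
  var : ℕ → Formula
  ∼_  : Formula → Formula
  _·_ : Formula → Formula → Formula

infix  6 ∼_
infixl 5 _·_

Seq : Set
Seq = List Formula

_,,_ : Seq → Formula → Seq
Δ ,, P = Δ ++ [ P ]

infixl 4 _,,_

_⊃_ : Formula → Formula → Formula
P ⊃ Q = ∼ (P · ∼ Q)

infix 3 _⊢_

-- Derivations in the system 𝒩 (sequent Δ → P written Δ ⊢ P)
data _⊢_ : Seq → Formula → Set where
  ax       : ∀ {P} → [ P ] ⊢ P
  thinL    : ∀ {Δ P Q} → Δ ⊢ Q → (P ∷ Δ) ⊢ Q
  thinR    : ∀ {Δ P Q} → Δ ⊢ Q → (Δ ,, P) ⊢ Q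
  ·I       : ∀ {Δ P Q} → Δ ⊢ P → Δ ⊢ Q → Δ ⊢ P · Q
  ·E₁      : ∀ {Δ P Q} → Δ ⊢ P · Q → Δ ⊢ P
  ·E₂      : ∀ {Δ P Q} → Δ ⊢ P · Q → Δ ⊢ Q
  cut      : ∀ {Δ P Q R} → [ R ] ⊢ P → (Δ ,, P) ⊢ Q → (Δ ,, R) ⊢ Q
  raa      : ∀ {Δ P Q} → (Δ ,, ∼ P) ⊢ Q → (Δ ,, ∼ P) ⊢ ∼ Q → Δ ⊢ P

-- Both rules are proved by reductio on a negated hypothesis. For (i), assume ∼∼(P · ∼Q):
-- double negation gives P · ∼Q, whose components yield Q (via the premise) and ∼Q.
-- For (ii), assume ∼Q: together with Δ ⊢ P it yields P · ∼Q, contradicting Δ ⊢ ∼(P · ∼Q).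
module Submission where

open import Defs
open import Data.Product using (_×_; _,_)
open import Data.List using ([]; _∷_; [_]; _++_)

thinLs : ∀ {Γ Q} (Δ : Seq) → Γ ⊢ Q → Δ ++ Γ ⊢ Q
thinLs []      d = d
thinLs (_ ∷ Δ) d = thinL (thinLs Δ d)

hyp : ∀ {P} (Δ : Seq) → Δ ,, P ⊢ P
hyp Δ = thinLs Δ ax

∼∼-elim : ∀ {P} → [ ∼ ∼ P ] ⊢ P
∼∼-elim = raa (thinL ax) (thinR ax)

-- Cut replaces the last hypothesis only by a single formula, hence the detour through
-- the one-formula sequents P · ∼Q ⊢ P and P · ∼Q ⊢ ∼Q.
⊃-intro : ∀ {Δ P Q} → Δ ,, P ⊢ Q → Δ ⊢ P ⊃ Q
⊃-intro {Δ} d = raa (cut ∼∼-elim (cut (·E₁ ax) d))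
                    (cut ∼∼-elim (cut (·E₂ ax) (hyp Δ)))

⊃-elim : ∀ {Δ P Q} → Δ ⊢ P → Δ ⊢ P ⊃ Q → Δ ⊢ Q
⊃-elim {Δ} p p⊃q = raa (·I (thinR p) (hyp Δ)) (thinR p⊃q)

mainTheorem6 : (P Q : Formula) (Δ : Seq)
    → ((Δ ,, P) ⊢ Q → Δ ⊢ ∼ (P · ∼ Q))
    × (Δ ⊢ P → Δ ⊢ ∼ (P · ∼ Q) → Δ ⊢ Q)
mainTheorem6 P Q Δ = ⊃-intro , ⊃-elim
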